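{- Let $a$ be a positive odd integer, let $m$ be a nonnegative integer and let $n$ be a positive integer. If $n\equiv m+\frac{a-1}2\pmod 2$, then $$t(a,3a,8m+4,8m+4;n)=\frac 23N(a,3a,8m+4,8m+4;8n+16m+4a+8)-2N(a,3a,8m+4,8m+4;2n+4m+a+2).$$
   Context: For positive integers $a,b,c,d$ and a nonnegative integer $n$, $N(a,b,c,d;n)$ denotes the number of $(x,y,z,w)\in\mathbb Z^4$ with $n=ax^2+by^2+cz^2+dw^2$, and $t(a,b,c,d;n)$ denotes the number of $(x,y,z,w)\in\mathbb Z^4$ with $n=a\frac{x(x-1)}2+b\frac{y(y-1)}2+c\frac{z(z-1)}2+d\frac{w(w-1)}2$. -}

module Defs where

open import Data.Nat using (ℕ; suc; _*_; _+_)
open import Data.Integer as ℤ using (ℤ; +_)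
open import Data.List using (List; map; upTo; length; filter; concatMap)
open import Data.Product using (_×_; _,_)
open import Relation.Binary.PropositionalEquality using (_≡_)
open import Relation.Nullary using (Dec)
import Data.Integer.Properties as ℤP

range : ℕ → List ℤ
range B = map (λ i → + i ℤ.- + B) (upTo (suc (B + B)))

box : ℕ → List (ℤ × ℤ × ℤ × ℤ)
box B = concatMap (λ x → concatMap (λ y → concatMap (λ z → map (λ w → (x , y , z , w))
          (range B)) (range B)) (range B)) (range B)

Q : ℕ → ℕ → ℕ → ℕ → ℤ × ℤ × ℤ × ℤ → ℤ
Q a b c d (x , y , z , w) = + a ℤ.* (x ℤ.* x) ℤ.+ + b ℤ.* (y ℤ.* y)
                          ℤ.+ + c ℤ.* (z ℤ.* z) ℤ.+ + d ℤ.* (w ℤ.* w)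

-- Twice the triangular form: a x(x-1) + b y(y-1) + c z(z-1) + d w(w-1)
-- (equals 2·(a x(x-1)/2 + ...)).
T2 : ℕ → ℕ → ℕ → ℕ → ℤ × ℤ × ℤ × ℤ → ℤ
T2 a b c d (x , y , z , w) = + a ℤ.* (x ℤ.* (x ℤ.- + 1)) ℤ.+ + b ℤ.* (y ℤ.* (y ℤ.- + 1))
                           ℤ.+ + c ℤ.* (z ℤ.* (z ℤ.- + 1)) ℤ.+ + d ℤ.* (w ℤ.* (w ℤ.- + 1))

-- For positive a,b,c,d every solution satisfies |x|,|y|,|z|,|w| ≤ n,
-- so counting inside the box [-(n+1), n+1]^4 counts all of ℤ⁴.
N : ℕ → ℕ → ℕ → ℕ → ℕ → ℕ
N a b c d n = length (filter (λ v → Q a b c d v ℤP.≟ + n) (box (suc n)))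

-- t(a,b,c,d;n) = #{(x,y,z,w) ∈ ℤ⁴ : n = a x(x-1)/2 + b y(y-1)/2 + c z(z-1)/2 + d w(w-1)/2}.
-- For positive a,b,c,d every solution satisfies |x|,... ≤ n+1.
t : ℕ → ℕ → ℕ → ℕ → ℕ → ℕ
t a b c d n = length (filter (λ v → T2 a b c d v ℤP.≟ + (2 * n)) (box (suc n)))

{-# OPTIONS --safe #-}
-- Write c = 8m + 4 and K = 2n + 4m + a + 2, so that the level 8n + 16m + 4a + 8 of
-- the first N equals 4K = 4·(2n) + (a + 3a + c + c).  Every representation of 4K by
-- a x² + 3a y² + c z² + c w² has x ≡ y and z ≡ w (mod 2).  The representations with all
-- coordinates even are twice those of K, and those with all coordinates odd are 2v − 1 for
-- the solutions v counted by t.  Putting x = y + 2k turns the form into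
-- 4a(y² + yk + k²) + c(z² + w²), and (y, k) ↦ (k, −y − k), multiplication by a cube root of
-- unity in ℤ[ω], preserves it while cycling the parity classes (1,0), (0,1), (1,1) of (y, k);
-- the class (0,0) is empty because of the parity condition on n (a computation mod 4).
-- So among the representations with z even (resp. odd) exactly one third have y even, and
-- N(4K) = 3·N(K) + 3·t/2.
module Submission where

open import Defs
open import Data.Empty using (⊥-elim)
open import Data.Integer as ℤ using (ℤ; +_; -[1+_]; ∣_∣)
import Data.Integer.Properties as ℤP
open import Algebra.Properties.AbelianGroup ℤP.+-0-abelianGroup using (∙-cancelˡ; ∙-cancelʳ)
open import Data.Integer.DivMod using (_/ℕ_; _%ℕ_; a≡a%ℕn+[a/ℕn]*n; n%ℕd<d)
open import Data.Integer.Divisibility.Signed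
  using (_∣_; divides; _∣?_; ∣ᵤ⇒∣; ∣⇒∣ᵤ; ∣-trans; ∣m∣n⇒∣m+n; ∣m∣n⇒∣m-n; ∣m+n∣m⇒∣n; ∣m+n∣n⇒∣m;
         ∣m⇒∣m*n; ∣n⇒∣m*n; ∣m⇒∣-m; *-monoʳ-∣)
open import Data.Integer.Tactic.RingSolver using (solve-∀)
open import Data.List using (List; []; _∷_; length; map; filter; concatMap; cartesianProduct; _++_)
open import Data.List.Properties using (length-map; map-++; map-∘; map-id; concatMap-cong)
open import Data.List.Membership.Propositional using (_∈_)
import Data.List.Membership.Propositional.Properties as ∈
open import Data.List.Membership.Propositional.Properties.WithK using (unique∧set⇒bag)
open import Data.List.Relation.Unary.Any using (here; there)
import Data.List.Relation.Unary.All as All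
import Data.List.Relation.Unary.All.Properties as All
open import Data.List.Relation.Unary.Unique.Propositional using (Unique; []; _∷_)
import Data.List.Relation.Unary.Unique.Propositional.Properties as Unique
open import Data.List.Relation.Binary.BagAndSetEquality using (∼bag⇒↭)
open import Data.List.Relation.Binary.Permutation.Propositional.Properties using (↭-length)
open import Data.Nat as ℕ using (ℕ; zero; suc; _+_; _*_; _∸_; _%_; _/_; _<_; _≤_; z≤n; s≤s; NonZero)
import Data.Nat.Properties as ℕP
open import Data.Nat.DivMod using (m≡m%n+[m/n]*n; m*n/n≡m)
import Data.Nat.Divisibility as ℕ using (_∣_; >⇒∤)
open import Data.Nat.Primality using (euclidsLemma; prime[2])
import Data.Nat.Tactic.RingSolver as ℕ-Solver
open import Data.Product using (_×_; _,_; proj₁; proj₂)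
open import Data.Sum using (_⊎_; inj₁; inj₂; [_,_]′; reduce)
import Data.Sum as Sum
open import Function using (id; _∘_; mk⇔)
open import Level using (0ℓ)
open import Relation.Binary.PropositionalEquality
open import Relation.Nullary using (¬_; yes; no)
open import Relation.Unary using (Pred; Decidable; _∩_; ∁; _⊆_)
open import Relation.Unary.Properties using (∁?)

private variable
  A A′ : Set
  P P′ R R′ U : Pred A 0ℓ
  xs ys : List A

-- Counting the elements of a predicate

record Enumerates (P : Pred A 0ℓ) (xs : List A) : Set where
  field
    unique   : Unique xs
    sound    : ∀ {v} → v ∈ xs → P v
    complete : ∀ {v} → P v → v ∈ xs
open Enumerates

record _⇿_ {A B : Set} (P : Pred A 0ℓ) (R : Pred B 0ℓ) : Set where
  field
    to      : A → B
    from    : B → A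
    to-∈    : ∀ {v} → P v → R (to v)
    from-∈  : ∀ {v} → R v → P (from v)
    from∘to : ∀ {v} → P v → from (to v) ≡ v
    to∘from : ∀ {v} → R v → to (from v) ≡ v
open _⇿_

⇿-trans : P ⇿ R → R ⇿ U → P ⇿ U
⇿-trans e f = record
  { to      = to f ∘ to e
  ; from    = from e ∘ from f
  ; to-∈    = to-∈ f ∘ to-∈ e
  ; from-∈  = from-∈ e ∘ from-∈ f
  ; from∘to = λ p → trans (cong (from e) (from∘to f (to-∈ e p))) (from∘to e p)
  ; to∘from = λ s → trans (cong (to f) (to∘from e (from-∈ f s))) (to∘from f s)
  }

⇿-restrict : (e : P ⇿ R) → P′ ⊆ P → R′ ⊆ R →
             (∀ {v} → P′ v → R′ (to e v)) → (∀ {v} → R′ v → P′ (from e v)) → P′ ⇿ R′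
⇿-restrict e P′⊆P R′⊆R to-∈′ from-∈′ = record
  { to      = to e
  ; from    = from e
  ; to-∈    = to-∈′
  ; from-∈  = from-∈′
  ; from∘to = from∘to e ∘ P′⊆P
  ; to∘from = to∘from e ∘ R′⊆R
  }

unique-map : (f : A → A′) → (∀ {v w} → v ∈ xs → w ∈ xs → f v ≡ f w → v ≡ w) →
             Unique xs → Unique (map f xs)
unique-map f inj [] = []
unique-map f inj (v∉vs ∷ vs!) =
  All.map⁺ (All.tabulate λ w∈vs fv≡fw → All.lookup v∉vs w∈vs (inj (here refl) (there w∈vs) fv≡fw))
  ∷ unique-map f (λ v∈ w∈ → inj (there v∈) (there w∈)) vs!

enumerates-map : (e : P ⇿ R) → Enumerates P xs → Enumerates R (map (to e) xs)
enumerates-map {R = R} {xs = xs} e E = record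
  { unique   = unique-map (to e) injective (unique E)
  ; sound    = λ w∈ → let v , v∈xs , w≡ = ∈.∈-map⁻ (to e) w∈ in subst R (sym w≡) (to-∈ e (sound E v∈xs))
  ; complete = λ r → subst (_∈ map (to e) xs) (to∘from e r) (∈.∈-map⁺ (to e) (complete E (from-∈ e r)))
  }
  where
  injective : ∀ {v w} → v ∈ xs → w ∈ xs → to e v ≡ to e w → v ≡ w
  injective v∈ w∈ eq =
    trans (sym (from∘to e (sound E v∈))) (trans (cong (from e) eq) (from∘to e (sound E w∈)))

enumerations-length : Enumerates P xs → Enumerates P ys → length xs ≡ length ys
enumerations-length E F =
  ↭-length (∼bag⇒↭ (unique∧set⇒bag (unique E) (unique F)
    (mk⇔ (complete F ∘ sound E) (complete E ∘ sound F))))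

length-⇿ : P ⇿ R → Enumerates P xs → Enumerates R ys → length xs ≡ length ys
length-⇿ {xs = xs} e E F = trans (sym (length-map (to e) xs)) (enumerations-length (enumerates-map e E) F)

enumerates-filter : (R? : Decidable R) → Enumerates P xs → Enumerates (P ∩ R) (filter R? xs)
enumerates-filter {xs = xs} R? E = record
  { unique   = Unique.filter⁺ R? (unique E)
  ; sound    = λ v∈ → let v∈xs , r = ∈.∈-filter⁻ R? {xs = xs} v∈ in sound E v∈xs , r
  ; complete = λ (p , r) → ∈.∈-filter⁺ R? (complete E p) r
  }

enumerates-filter-complete : (P? : Decidable P) → Unique xs → P ⊆ (_∈ xs) → Enumerates P (filter P? xs)
enumerates-filter-complete {xs = xs} P? xs! P⊆xs = record
  { unique   = Unique.filter⁺ P? xs!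
  ; sound    = λ v∈ → proj₂ (∈.∈-filter⁻ P? {xs = xs} v∈)
  ; complete = λ p → ∈.∈-filter⁺ P? (P⊆xs p) p
  }

enumerates-empty : Enumerates P xs → (∀ {v} → ¬ P v) → length xs ≡ 0
enumerates-empty {xs = []}    E P-empty = refl
enumerates-empty {xs = _ ∷ _} E P-empty with () ← P-empty (sound E (here refl))

length-filter-split : (R? : Decidable R) (xs : List A) →
                      length xs ≡ length (filter R? xs) + length (filter (∁? R?) xs)
length-filter-split R? []       = refl
length-filter-split R? (x ∷ xs) with R? x
... | yes _ = cong suc (length-filter-split R? xs)
... | no  _ = trans (cong suc (length-filter-split R? xs)) (sym (ℕP.+-suc _ _))

-- The box and the level sets of Q and T2

ℤ⁴ : Set
ℤ⁴ = ℤ × ℤ × ℤ × ℤ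

map-cartesianProduct : {C : Set} (g : A × A′ → C) (xs : List A) (ys : List A′) →
  map g (cartesianProduct xs ys) ≡ concatMap (λ x → map (λ y → g (x , y)) ys) xs
map-cartesianProduct g []       ys = refl
map-cartesianProduct g (x ∷ xs) ys = begin
  map g (map (x ,_) ys ++ cartesianProduct xs ys)
    ≡⟨ map-++ g (map (x ,_) ys) (cartesianProduct xs ys) ⟩
  map g (map (x ,_) ys) ++ map g (cartesianProduct xs ys)
    ≡⟨ cong₂ _++_ (sym (map-∘ ys)) (map-cartesianProduct g xs ys) ⟩
  map (λ y → g (x , y)) ys ++ concatMap (λ x → map (λ y → g (x , y)) ys) xs ∎
  where open ≡-Reasoning

box≡cartesianProduct : ∀ B → let r = range B in
  box B ≡ cartesianProduct r (cartesianProduct r (cartesianProduct r r))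
box≡cartesianProduct B = sym (begin
  cartesianProduct r (cartesianProduct r (cartesianProduct r r))
    ≡⟨ sym (map-id _) ⟩
  map id (cartesianProduct r (cartesianProduct r (cartesianProduct r r)))
    ≡⟨ map-cartesianProduct id r _ ⟩
  concatMap (λ x → map (x ,_) (cartesianProduct r (cartesianProduct r r))) r
    ≡⟨ concatMap-cong (λ x → trans (map-cartesianProduct (x ,_) r _)
         (concatMap-cong (λ y → map-cartesianProduct (λ zw → x , y , zw) r r) r)) r ⟩
  box B ∎)
  where
  open ≡-Reasoning
  r : List ℤ
  r = range B

unique-range : ∀ B → Unique (range B)
unique-range B = Unique.map⁺ (λ eq → ℤP.+-injective (∙-cancelʳ (ℤ.- + B) _ _ eq)) (Unique.upTo⁺ _)

unique-box : ∀ B → Unique (box B)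
unique-box B = subst Unique (sym (box≡cartesianProduct B))
  (Unique.cartesianProduct⁺ r! (Unique.cartesianProduct⁺ r! (Unique.cartesianProduct⁺ r! r!)))
  where
  r! : Unique (range B)
  r! = unique-range B

∈-range : ∀ {B} x → ∣ x ∣ ≤ B → x ∈ range B
∈-range {B} (+ k) k≤B = subst (_∈ range B) (shift (+ k) (+ B))
  (∈.∈-map⁺ _ (∈.∈-upTo⁺ (s≤s (ℕP.+-monoˡ-≤ B k≤B))))
  where
  shift : ∀ i j → i ℤ.+ j ℤ.- j ≡ i
  shift = solve-∀
∈-range {B} -[1+ k ] k<B = subst (_∈ range B) eq
  (∈.∈-map⁺ _ (∈.∈-upTo⁺ (s≤s (ℕP.≤-trans (ℕP.m∸n≤m B (suc k)) (ℕP.m≤m+n B B)))))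
  where
  shift : ∀ i j → i ℤ.- (j ℤ.+ i) ≡ ℤ.- j
  shift = solve-∀
  eq : + (B ∸ suc k) ℤ.- + B ≡ -[1+ k ]
  eq = trans (cong (λ b → + (B ∸ suc k) ℤ.- + b) (sym (ℕP.m+[n∸m]≡n k<B))) (shift (+ (B ∸ suc k)) (+ suc k))

∈-box : ∀ {B x y z w} → ∣ x ∣ ≤ B → ∣ y ∣ ≤ B → ∣ z ∣ ≤ B → ∣ w ∣ ≤ B → (x , y , z , w) ∈ box B
∈-box {B} {x} {y} {z} {w} bx by bz bw = subst ((x , y , z , w) ∈_) (sym (box≡cartesianProduct B))
  (∈.∈-cartesianProduct⁺ (∈-range x bx) (∈.∈-cartesianProduct⁺ (∈-range y by)
    (∈.∈-cartesianProduct⁺ (∈-range z bz) (∈-range w bw))))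

square-abs : ∀ x → x ℤ.* x ≡ + (∣ x ∣ * ∣ x ∣)
square-abs (+ n)    = ℤP.+◃n≡+n (n * n)
square-abs -[1+ n ] = refl

pronic-abs : ∀ x → x ℤ.* (x ℤ.- + 1) ≡ + (∣ x ∣ * ∣ x ℤ.- + 1 ∣)
pronic-abs (+ zero)  = refl
pronic-abs (+ suc n) = sym (ℤP.pos-* (suc n) n)
pronic-abs -[1+ n ]  = refl

square-bound : ∀ {m R} → m * m ≤ R → m ≤ suc R
square-bound {zero}  _  = z≤n
square-bound {suc m} sq = ℕP.m≤n⇒m≤1+n (ℕP.≤-trans (ℕP.m≤m*n (suc m) (suc m)) sq)

pronic-bound : ∀ x {n} → ∣ x ∣ * ∣ x ℤ.- + 1 ∣ ≤ 2 * n → ∣ x ∣ ≤ suc n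
pronic-bound (+ zero)        _ = z≤n
pronic-bound (+ suc zero)    _ = s≤s z≤n
pronic-bound (+ suc (suc m)) p =
  s≤s (ℕP.*-cancelˡ-≤ 2 (ℕP.≤-trans (ℕP.*-monoˡ-≤ (suc m) {2} {suc (suc m)} (s≤s (s≤s z≤n))) p))
pronic-bound -[1+ m ]        p = ℕP.m≤n⇒m≤1+n (ℕP.*-cancelˡ-≤ 2 (ℕP.≤-trans
  (ℕP.≤-reflexive (ℕP.*-comm 2 (suc m))) (ℕP.≤-trans (ℕP.*-monoʳ-≤ (suc m) (s≤s (s≤s z≤n))) p)))

weighted-sum-bounds : ∀ a b c d {p q r s R} .{{_ : NonZero a}} .{{_ : NonZero b}}
  .{{_ : NonZero c}} .{{_ : NonZero d}} → a * p + b * q + c * r + d * s ≡ R →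
  p ≤ R × q ≤ R × r ≤ R × s ≤ R
weighted-sum-bounds a b c d {p} {q} {r} {s} refl =
  ℕP.≤-trans (ℕP.m≤n*m p a) (ℕP.≤-trans (ℕP.m≤m+n (a * p) _) (ℕP.≤-trans (ℕP.m≤m+n _ (c * r)) (ℕP.m≤m+n _ (d * s)))) ,
  ℕP.≤-trans (ℕP.m≤n*m q b) (ℕP.≤-trans (ℕP.m≤n+m (b * q) _) (ℕP.≤-trans (ℕP.m≤m+n _ (c * r)) (ℕP.m≤m+n _ (d * s)))) ,
  ℕP.≤-trans (ℕP.m≤n*m r c) (ℕP.≤-trans (ℕP.m≤n+m (c * r) _) (ℕP.m≤m+n _ (d * s))) ,
  ℕP.≤-trans (ℕP.m≤n*m s d) (ℕP.m≤n+m (d * s) _)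

pos-+₄ : ∀ p q r s → + (p + q + r + s) ≡ + p ℤ.+ + q ℤ.+ + r ℤ.+ + s
pos-+₄ p q r s = trans (ℤP.pos-+ (p + q + r) s)
  (cong (ℤ._+ + s) (trans (ℤP.pos-+ (p + q) r) (cong (ℤ._+ + r) (ℤP.pos-+ p q))))

weighted-sum-abs : ∀ a b c d (f : ℤ → ℤ) (g : ℤ → ℕ) → (∀ x → f x ≡ + g x) → ∀ x y z w →
  + a ℤ.* f x ℤ.+ + b ℤ.* f y ℤ.+ + c ℤ.* f z ℤ.+ + d ℤ.* f w ≡ + (a * g x + b * g y + c * g z + d * g w)
weighted-sum-abs a b c d f g f≡g x y z w =
  trans (cong₂ ℤ._+_ (cong₂ ℤ._+_ (cong₂ ℤ._+_ (term a x) (term b y)) (term c z)) (term d w))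
        (sym (pos-+₄ (a * g x) (b * g y) (c * g z) (d * g w)))
  where
  term : ∀ k v → + k ℤ.* f v ≡ + (k * g v)
  term k v = trans (cong (+ k ℤ.*_) (f≡g v)) (sym (ℤP.pos-* k (g v)))

Q-level : ℕ → ℕ → ℕ → ℕ → ℕ → Pred ℤ⁴ 0ℓ
Q-level a b c d R v = Q a b c d v ≡ + R

T2-level : ℕ → ℕ → ℕ → ℕ → ℕ → Pred ℤ⁴ 0ℓ
T2-level a b c d n v = T2 a b c d v ≡ + (2 * n)

Q-level⊆box : ∀ a b c d .{{_ : NonZero a}} .{{_ : NonZero b}} .{{_ : NonZero c}} .{{_ : NonZero d}} R →
  Q-level a b c d R ⊆ (_∈ box (suc R))
Q-level⊆box a b c d R {x , y , z , w} eq =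
  let bx , by , bz , bw = weighted-sum-bounds a b c d (ℤP.+-injective
        (trans (sym (weighted-sum-abs a b c d _ _ square-abs x y z w)) eq))
  in ∈-box (square-bound bx) (square-bound by) (square-bound bz) (square-bound bw)

T2-level⊆box : ∀ a b c d .{{_ : NonZero a}} .{{_ : NonZero b}} .{{_ : NonZero c}} .{{_ : NonZero d}} n →
  T2-level a b c d n ⊆ (_∈ box (suc n))
T2-level⊆box a b c d n {x , y , z , w} eq =
  let bx , by , bz , bw = weighted-sum-bounds a b c d (ℤP.+-injective
        (trans (sym (weighted-sum-abs a b c d _ _ pronic-abs x y z w)) eq))
  in ∈-box (pronic-bound x bx) (pronic-bound y by) (pronic-bound z bz) (pronic-bound w bw)

N-enumerates : ∀ a b c d .{{_ : NonZero a}} .{{_ : NonZero b}} .{{_ : NonZero c}} .{{_ : NonZero d}} R →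
  Enumerates (Q-level a b c d R) (filter (λ v → Q a b c d v ℤP.≟ + R) (box (suc R)))
N-enumerates a b c d R =
  enumerates-filter-complete (λ v → Q a b c d v ℤP.≟ + R) (unique-box (suc R)) (Q-level⊆box a b c d R)

t-enumerates : ∀ a b c d .{{_ : NonZero a}} .{{_ : NonZero b}} .{{_ : NonZero c}} .{{_ : NonZero d}} n →
  Enumerates (T2-level a b c d n) (filter (λ v → T2 a b c d v ℤP.≟ + (2 * n)) (box (suc n)))
t-enumerates a b c d n =
  enumerates-filter-complete (λ v → T2 a b c d v ℤP.≟ + (2 * n)) (unique-box (suc n)) (T2-level⊆box a b c d n)

-- Parity

Even : Pred ℤ 0ℓ
Even x = + 2 ∣ x

even? : Decidable Even
even? x = + 2 ∣? x

¬even-1 : ¬ Even (+ 1)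
¬even-1 2∣1 = ℕ.>⇒∤ (s≤s (s≤s z≤n)) (∣⇒∣ᵤ 2∣1)

¬4∣2 : ¬ (+ 4 ∣ + 2)
¬4∣2 4∣2 = ℕ.>⇒∤ (s≤s (s≤s (s≤s z≤n))) (∣⇒∣ᵤ 4∣2)

2∣4 : + 2 ∣ + 4
2∣4 = divides (+ 2) refl

even-*2 : ∀ x → Even (x ℤ.* + 2)
even-*2 x = divides x refl

¬even-1+*2 : ∀ p → ¬ Even (+ 1 ℤ.+ p ℤ.* + 2)
¬even-1+*2 p (divides q eq) =
  ¬even-1 (divides (q ℤ.- p) (trans (cancel p) (trans (cong (ℤ._- p ℤ.* + 2) eq) (sym (distrib q p)))))
  where
  cancel : ∀ p → + 1 ≡ (+ 1 ℤ.+ p ℤ.* + 2) ℤ.- p ℤ.* + 2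
  cancel = solve-∀
  distrib : ∀ q p → (q ℤ.- p) ℤ.* + 2 ≡ q ℤ.* + 2 ℤ.- p ℤ.* + 2
  distrib = solve-∀

-- Floor division: exact only on even arguments.
half : ℤ → ℤ
half x = x /ℕ 2

data Parity (x : ℤ) : Set where
  even : x ≡ half x ℤ.* + 2 → Parity x
  odd  : x ≡ + 1 ℤ.+ half x ℤ.* + 2 → Parity x

parity : ∀ x → Parity x
parity x with x %ℕ 2 | n%ℕd<d x 2 | a≡a%ℕn+[a/ℕn]*n x 2
... | 0           | _            | eq = even (trans eq (ℤP.+-identityˡ _))
... | 1           | _            | eq = odd eq
... | suc (suc _) | s≤s (s≤s ()) | _

even⇒≡half*2 : ∀ {x} → Even x → x ≡ half x ℤ.* + 2
even⇒≡half*2 {x} (divides q x≡q*2) with parity x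
... | even eq = eq
... | odd  eq = ⊥-elim (¬even-1+*2 (half x) (divides q (trans (sym eq) x≡q*2)))

odd⇒≡1+half*2 : ∀ {x} → ¬ Even x → x ≡ + 1 ℤ.+ half x ℤ.* + 2
odd⇒≡1+half*2 {x} x-odd with parity x
... | even eq = ⊥-elim (x-odd (divides (half x) eq))
... | odd  eq = eq

half-*2 : ∀ q → half (q ℤ.* + 2) ≡ q
half-*2 q with parity (q ℤ.* + 2)
... | even eq = sym (ℤP.*-cancelʳ-≡ q (half (q ℤ.* + 2)) (+ 2) eq)
... | odd  eq = ⊥-elim (¬even-1+*2 (half (q ℤ.* + 2)) (divides q (sym eq)))

half-1+*2 : ∀ q → half (+ 1 ℤ.+ q ℤ.* + 2) ≡ q
half-1+*2 q with parity (+ 1 ℤ.+ q ℤ.* + 2)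
... | even eq = ⊥-elim (¬even-1+*2 q (divides (half (+ 1 ℤ.+ q ℤ.* + 2)) eq))
... | odd  eq = sym (ℤP.*-cancelʳ-≡ q (half (+ 1 ℤ.+ q ℤ.* + 2)) (+ 2) (∙-cancelˡ (+ 1) _ _ eq))

even-or-even-suc : ∀ x → Even x ⊎ Even (x ℤ.+ + 1)
even-or-even-suc x with parity x
... | even eq = inj₁ (divides (half x) eq)
... | odd  eq = inj₂ (divides (half x ℤ.+ + 1) (trans (cong (ℤ._+ + 1) eq) (regroup (half x))))
  where
  regroup : ∀ h → + 1 ℤ.+ h ℤ.* + 2 ℤ.+ + 1 ≡ (h ℤ.+ + 1) ℤ.* + 2
  regroup = solve-∀

odd⇒even-suc : ∀ {x} → ¬ Even x → Even (x ℤ.+ + 1)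
odd⇒even-suc {x} x-odd = [ ⊥-elim ∘ x-odd , id ]′ (even-or-even-suc x)

odd-suc⇒even : ∀ {x} → ¬ Even (x ℤ.+ + 1) → Even x
odd-suc⇒even {x} x+1-odd = [ id , ⊥-elim ∘ x+1-odd ]′ (even-or-even-suc x)

even-*⁻ : ∀ {x y} → Even (x ℤ.* y) → Even x ⊎ Even y
even-*⁻ {x} {y} 2∣xy = Sum.map ∣ᵤ⇒∣ ∣ᵤ⇒∣
  (euclidsLemma ∣ x ∣ ∣ y ∣ prime[2] (subst (2 ℕ.∣_) (ℤP.abs-* x y) (∣⇒∣ᵤ 2∣xy)))

even-square⁻ : ∀ {x} → Even (x ℤ.* x) → Even x
even-square⁻ = reduce ∘ even-*⁻

even-*-odd⁻ : ∀ {x y} → ¬ Even x → Even (x ℤ.* y) → Even y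
even-*-odd⁻ x-odd 2∣xy = [ ⊥-elim ∘ x-odd , id ]′ (even-*⁻ 2∣xy)

even-pronic : ∀ x → Even (x ℤ.* (x ℤ.+ + 1))
even-pronic x = [ ∣m⇒∣m*n (x ℤ.+ + 1) , ∣n⇒∣m*n x ]′ (even-or-even-suc x)

even-+-odd : ∀ {x y} → ¬ Even x → ¬ Even y → Even (x ℤ.+ y)
even-+-odd {x} {y} x-odd y-odd = subst Even (regroup x y)
  (∣m∣n⇒∣m-n (∣m∣n⇒∣m+n (odd⇒even-suc x-odd) (odd⇒even-suc y-odd)) (even-*2 (+ 1)))
  where
  regroup : ∀ x y → x ℤ.+ + 1 ℤ.+ (y ℤ.+ + 1) ℤ.- + 1 ℤ.* + 2 ≡ x ℤ.+ y
  regroup = solve-∀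

even-neg⁻ : ∀ {x} → Even (ℤ.- x) → Even x
even-neg⁻ {x} 2∣-x = subst Even (ℤP.neg-involutive x) (∣m⇒∣-m 2∣-x)

4∣even*even : ∀ {x y} → Even x → Even y → + 4 ∣ x ℤ.* y
4∣even*even (divides p refl) (divides q refl) = divides (p ℤ.* q) (regroup p q)
  where
  regroup : ∀ p q → p ℤ.* + 2 ℤ.* (q ℤ.* + 2) ≡ p ℤ.* q ℤ.* + 4
  regroup = solve-∀

4∣sum-of-squares-1 : ∀ {z w} → ¬ Even (z ℤ.- w) → + 4 ∣ z ℤ.* z ℤ.+ w ℤ.* w ℤ.- + 1
4∣sum-of-squares-1 {z} {w} z-w-odd = subst (+ 4 ∣_) (sym (expand z w))
  (∣m∣n⇒∣m+n (∣m∣n⇒∣m+n (4∣even*even d-even d-even) (*-monoʳ-∣ (+ 2) (∣m⇒∣m*n (w ℤ.- + 1) d-even)))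
             (*-monoʳ-∣ (+ 2) (even-pronic (w ℤ.- + 1))))
  where
  d-even : Even (z ℤ.- w ℤ.+ + 1)
  d-even = odd⇒even-suc z-w-odd
  expand : ∀ z w → z ℤ.* z ℤ.+ w ℤ.* w ℤ.- + 1
    ≡ (z ℤ.- w ℤ.+ + 1) ℤ.* (z ℤ.- w ℤ.+ + 1) ℤ.+ + 2 ℤ.* ((z ℤ.- w ℤ.+ + 1) ℤ.* (w ℤ.- + 1))
      ℤ.+ + 2 ℤ.* ((w ℤ.- + 1) ℤ.* (w ℤ.- + 1 ℤ.+ + 1))
  expand = solve-∀

-- Even and odd representations

map₄ : (ℤ → ℤ) → ℤ⁴ → ℤ⁴
map₄ f (x , y , z , w) = f x , f y , f z , f w

All₄ : Pred ℤ 0ℓ → Pred ℤ⁴ 0ℓ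
All₄ C (x , y , z , w) = C x × C y × C z × C w

coordinatewise-⇿ : {P R : Pred ℤ⁴ 0ℓ} (C : Pred ℤ 0ℓ) (f g : ℤ → ℤ) →
  (∀ x → g (f x) ≡ x) → (∀ {x} → C x → f (g x) ≡ x) → (∀ x → C (f x)) →
  (∀ {v} → P v → R (map₄ f v)) → (∀ {v} → R (map₄ f v) → P v) → P ⇿ (R ∩ All₄ C)
coordinatewise-⇿ {R = R} C f g g∘f f∘g C-f P⇒R R⇒P = record
  { to      = map₄ f
  ; from    = map₄ g
  ; to-∈    = λ {(x , y , z , w)} p → P⇒R p , C-f x , C-f y , C-f z , C-f w
  ; from-∈  = λ (r , cs) → R⇒P (subst R (sym (f∘g₄ cs)) r)
  ; from∘to = λ {(x , y , z , w)} _ → cong₄ (g∘f x) (g∘f y) (g∘f z) (g∘f w)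
  ; to∘from = λ (_ , cs) → f∘g₄ cs
  }
  where
  cong₄ : ∀ {x y z w x′ y′ z′ w′ : ℤ} → x ≡ x′ → y ≡ y′ → z ≡ z′ → w ≡ w′ →
          (x , y , z , w) ≡ (x′ , y′ , z′ , w′)
  cong₄ refl refl refl refl = refl
  f∘g₄ : ∀ {v} → All₄ C v → map₄ f (map₄ g v) ≡ v
  f∘g₄ {x , y , z , w} (cx , cy , cz , cw) = cong₄ (f∘g cx) (f∘g cy) (f∘g cz) (f∘g cw)

module _ (a b c d : ℕ) where

  Q-double : ∀ v → Q a b c d (map₄ (ℤ._* + 2) v) ≡ + 4 ℤ.* Q a b c d v
  Q-double (x , y , z , w) = expand (+ a) (+ b) (+ c) (+ d) x y z w
    where
    expand : ∀ a b c d x y z w →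
      a ℤ.* (x ℤ.* + 2 ℤ.* (x ℤ.* + 2)) ℤ.+ b ℤ.* (y ℤ.* + 2 ℤ.* (y ℤ.* + 2))
        ℤ.+ c ℤ.* (z ℤ.* + 2 ℤ.* (z ℤ.* + 2)) ℤ.+ d ℤ.* (w ℤ.* + 2 ℤ.* (w ℤ.* + 2))
      ≡ + 4 ℤ.* (a ℤ.* (x ℤ.* x) ℤ.+ b ℤ.* (y ℤ.* y) ℤ.+ c ℤ.* (z ℤ.* z) ℤ.+ d ℤ.* (w ℤ.* w))
    expand = solve-∀

  Q-double-pred : ∀ v → Q a b c d (map₄ (λ x → x ℤ.* + 2 ℤ.- + 1) v)
                      ≡ + 4 ℤ.* T2 a b c d v ℤ.+ (+ a ℤ.+ + b ℤ.+ + c ℤ.+ + d)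
  Q-double-pred (x , y , z , w) = expand (+ a) (+ b) (+ c) (+ d) x y z w
    where
    expand : ∀ a b c d x y z w →
      a ℤ.* ((x ℤ.* + 2 ℤ.- + 1) ℤ.* (x ℤ.* + 2 ℤ.- + 1)) ℤ.+ b ℤ.* ((y ℤ.* + 2 ℤ.- + 1) ℤ.* (y ℤ.* + 2 ℤ.- + 1))
        ℤ.+ c ℤ.* ((z ℤ.* + 2 ℤ.- + 1) ℤ.* (z ℤ.* + 2 ℤ.- + 1)) ℤ.+ d ℤ.* ((w ℤ.* + 2 ℤ.- + 1) ℤ.* (w ℤ.* + 2 ℤ.- + 1))
      ≡ + 4 ℤ.* (a ℤ.* (x ℤ.* (x ℤ.- + 1)) ℤ.+ b ℤ.* (y ℤ.* (y ℤ.- + 1))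
                 ℤ.+ c ℤ.* (z ℤ.* (z ℤ.- + 1)) ℤ.+ d ℤ.* (w ℤ.* (w ℤ.- + 1))) ℤ.+ (a ℤ.+ b ℤ.+ c ℤ.+ d)
    expand = solve-∀

  Q-level⇿even-reps : ∀ K → Q-level a b c d K ⇿ (Q-level a b c d (4 * K) ∩ All₄ Even)
  Q-level⇿even-reps K = coordinatewise-⇿ Even (ℤ._* + 2) half half-*2 (sym ∘ even⇒≡half*2) even-*2
    (λ {v} q → trans (Q-double v) (trans (cong (+ 4 ℤ.*_) q) (sym (ℤP.pos-* 4 K))))
    (λ {v} q → ℤP.*-cancelˡ-≡ (+ 4) _ _ (trans (sym (Q-double v)) (trans q (ℤP.pos-* 4 K))))

  T2-level⇿odd-reps : ∀ n → T2-level a b c d n ⇿ (Q-level a b c d (4 * (2 * n) + (a + b + c + d)) ∩ All₄ (∁ Even))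
  T2-level⇿odd-reps n = coordinatewise-⇿ (∁ Even) (λ x → x ℤ.* + 2 ℤ.- + 1) (λ x → half x ℤ.+ + 1)
    (λ x → trans (cong (λ t → half t ℤ.+ + 1) (shift x)) (trans (cong (ℤ._+ + 1) (half-1+*2 (x ℤ.- + 1))) (unshift x)))
    (λ {x} x-odd → trans (reshift (half x)) (sym (odd⇒≡1+half*2 x-odd)))
    (λ x → subst (¬_ ∘ Even) (sym (shift x)) (¬even-1+*2 (x ℤ.- + 1)))
    (λ {v} t → trans (Q-double-pred v) (trans (cong (λ s → + 4 ℤ.* s ℤ.+ _) t) (sym level)))
    (λ {v} q → ℤP.*-cancelˡ-≡ (+ 4) _ _ (∙-cancelʳ (+ a ℤ.+ + b ℤ.+ + c ℤ.+ + d) _ _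
       (trans (sym (Q-double-pred v)) (trans q level))))
    where
    shift : ∀ x → x ℤ.* + 2 ℤ.- + 1 ≡ + 1 ℤ.+ (x ℤ.- + 1) ℤ.* + 2
    shift = solve-∀
    unshift : ∀ x → x ℤ.- + 1 ℤ.+ + 1 ≡ x
    unshift = solve-∀
    reshift : ∀ h → (h ℤ.+ + 1) ℤ.* + 2 ℤ.- + 1 ≡ + 1 ℤ.+ h ℤ.* + 2
    reshift = solve-∀
    level : + (4 * (2 * n) + (a + b + c + d)) ≡ + 4 ℤ.* + (2 * n) ℤ.+ (+ a ℤ.+ + b ℤ.+ + c ℤ.+ + d)
    level = trans (ℤP.pos-+ (4 * (2 * n)) _) (cong₂ ℤ._+_ (ℤP.pos-* 4 (2 * n)) (pos-+₄ a b c d))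

-- Eisenstein coordinates

norm : ℤ → ℤ → ℤ
norm y k = y ℤ.* y ℤ.+ y ℤ.* k ℤ.+ k ℤ.* k

even-norm⁻ : ∀ {y k} → Even (norm y k) → Even y × Even k
even-norm⁻ {y} {k} 2∣N = odd-suc⇒even y+1-odd , odd-suc⇒even k+1-odd
  where
  expand : ∀ y k → y ℤ.* y ℤ.+ y ℤ.* k ℤ.+ k ℤ.* k ℤ.+ + 1 ≡ (y ℤ.+ + 1) ℤ.* (k ℤ.+ + 1)
    ℤ.+ (y ℤ.- + 1) ℤ.* (y ℤ.- + 1 ℤ.+ + 1) ℤ.+ (k ℤ.- + 1) ℤ.* (k ℤ.- + 1 ℤ.+ + 1)
  expand = solve-∀
  product-odd : ¬ Even ((y ℤ.+ + 1) ℤ.* (k ℤ.+ + 1))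
  product-odd 2∣p = ¬even-1 (∣m+n∣m⇒∣n (subst Even (sym (expand y k))
    (∣m∣n⇒∣m+n (∣m∣n⇒∣m+n 2∣p (even-pronic (y ℤ.- + 1))) (even-pronic (k ℤ.- + 1)))) 2∣N)
  y+1-odd : ¬ Even (y ℤ.+ + 1)
  y+1-odd = product-odd ∘ ∣m⇒∣m*n (k ℤ.+ + 1)
  k+1-odd : ¬ Even (k ℤ.+ + 1)
  k+1-odd = product-odd ∘ ∣n⇒∣m*n (y ℤ.+ + 1)

shear : ℤ⁴ → ℤ⁴
shear (y , k , z , w) = y ℤ.+ k ℤ.* + 2 , y , z , w

unshear : ℤ⁴ → ℤ⁴
unshear (x , y , z , w) = y , half (x ℤ.- y) , z , w

SameParity₁₂ : Pred ℤ⁴ 0ℓ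
SameParity₁₂ (x , y , _) = Even (x ℤ.- y)

shear-⇿ : (∀ {v} → P v → SameParity₁₂ v) → P ⇿ (P ∘ shear)
shear-⇿ {P = P} P⇒same-parity = record
  { to      = unshear
  ; from    = shear
  ; to-∈    = λ p → subst P (sym (shear∘unshear (P⇒same-parity p))) p
  ; from-∈  = id
  ; from∘to = shear∘unshear ∘ P⇒same-parity
  ; to∘from = λ {u} _ → unshear∘shear u
  }
  where
  shear∘unshear : ∀ {v} → SameParity₁₂ v → shear (unshear v) ≡ v
  shear∘unshear {x , y , z , w} 2∣x-y =
    cong (_, y , z , w) (trans (cong (λ t → y ℤ.+ t) (sym (even⇒≡half*2 2∣x-y))) (cancel x y))
    where
    cancel : ∀ x y → y ℤ.+ (x ℤ.- y) ≡ x
    cancel = solve-∀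
  unshear∘shear : ∀ u → unshear (shear u) ≡ u
  unshear∘shear (y , k , z , w) = cong (λ h → y , h , z , w) (trans (cong half (cancel y k)) (half-*2 k))
    where
    cancel : ∀ y k → y ℤ.+ k ℤ.* + 2 ℤ.- y ≡ k ℤ.* + 2
    cancel = solve-∀

-- Multiplication by ω on the Eisenstein integer y − kω, whose norm is norm y k.
rotate : ℤ⁴ → ℤ⁴
rotate (y , k , z , w) = k , ℤ.- (y ℤ.+ k) , z , w

rotate³ : ∀ u → rotate (rotate (rotate u)) ≡ u
rotate³ (y , k , z , w) = cong₂ _,_ (first y k) (cong₂ _,_ (second y k) refl)
  where
  first : ∀ y k → ℤ.- (k ℤ.+ ℤ.- (y ℤ.+ k)) ≡ y
  first = solve-∀
  second : ∀ y k → ℤ.- (ℤ.- (y ℤ.+ k) ℤ.+ ℤ.- (k ℤ.+ ℤ.- (y ℤ.+ k))) ≡ k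
  second = solve-∀

Q-3a : ∀ a c d x y z w → Q a (3 * a) c d (x , y , z , w)
  ≡ + a ℤ.* (x ℤ.* x) ℤ.+ + 3 ℤ.* + a ℤ.* (y ℤ.* y) ℤ.+ + c ℤ.* (z ℤ.* z) ℤ.+ + d ℤ.* (w ℤ.* w)
Q-3a a c d x y z w =
  cong (λ b → + a ℤ.* (x ℤ.* x) ℤ.+ b ℤ.* (y ℤ.* y) ℤ.+ + c ℤ.* (z ℤ.* z) ℤ.+ + d ℤ.* (w ℤ.* w)) (ℤP.pos-* 3 a)

Q-shear-rotate : ∀ a c d u → Q a (3 * a) c d (shear (rotate u)) ≡ Q a (3 * a) c d (shear u)
Q-shear-rotate a c d u@(y , k , z , w) = begin
  Q a (3 * a) c d (shear (rotate u))  ≡⟨ Q-3a a c d (k ℤ.+ ℤ.- (y ℤ.+ k) ℤ.* + 2) k z w ⟩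
  _                                    ≡⟨ norm-invariant (+ a) (+ c) (+ d) y k z w ⟩
  _                                    ≡⟨ sym (Q-3a a c d (y ℤ.+ k ℤ.* + 2) y z w) ⟩
  Q a (3 * a) c d (shear u)            ∎
  where
  open ≡-Reasoning
  norm-invariant : ∀ a c d y k z w →
    a ℤ.* ((k ℤ.+ ℤ.- (y ℤ.+ k) ℤ.* + 2) ℤ.* (k ℤ.+ ℤ.- (y ℤ.+ k) ℤ.* + 2)) ℤ.+ + 3 ℤ.* a ℤ.* (k ℤ.* k)
      ℤ.+ c ℤ.* (z ℤ.* z) ℤ.+ d ℤ.* (w ℤ.* w)
    ≡ a ℤ.* ((y ℤ.+ k ℤ.* + 2) ℤ.* (y ℤ.+ k ℤ.* + 2)) ℤ.+ + 3 ℤ.* a ℤ.* (y ℤ.* y)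
      ℤ.+ c ℤ.* (z ℤ.* z) ℤ.+ d ℤ.* (w ℤ.* w)
  norm-invariant = solve-∀

Even₁ Even₂ Even₃ : Pred ℤ⁴ 0ℓ
Even₁ (y , _) = Even y
Even₂ (_ , k , _) = Even k
Even₃ (_ , _ , z , _) = Even z

even₁? : Decidable Even₁
even₁? (y , _) = even? y

even₂? : Decidable Even₂
even₂? (_ , k , _) = even? k

even₃? : Decidable Even₃
even₃? (_ , _ , z , _) = even? z

odd-even⇒rotate : ∀ {u} → ¬ Even₁ u → Even₂ u → Even₁ (rotate u) × ¬ Even₂ (rotate u)
odd-even⇒rotate y-odd k-even = k-even , λ 2∣-[y+k] → y-odd (∣m+n∣n⇒∣m (even-neg⁻ 2∣-[y+k]) k-even)

even-odd⇒rotate : ∀ {u} → Even₁ u → ¬ Even₂ u → ¬ Even₁ (rotate u) × ¬ Even₂ (rotate u)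
even-odd⇒rotate y-even k-odd = k-odd , λ 2∣-[y+k] → k-odd (∣m+n∣m⇒∣n (even-neg⁻ 2∣-[y+k]) y-even)

odd-odd⇒rotate : ∀ {u} → ¬ Even₁ u → ¬ Even₂ u → ¬ Even₁ (rotate u) × Even₂ (rotate u)
odd-odd⇒rotate y-odd k-odd = k-odd , ∣m⇒∣-m (even-+-odd y-odd k-odd)

even-odd-part : List ℤ⁴ → List ℤ⁴
even-odd-part xs = filter (∁? even₂?) (filter even₁? xs)

module Rotation {P : Pred ℤ⁴ 0ℓ} (rotate-closed : ∀ {u} → P u → P (rotate u)) where

  odd-even⇿even-odd : ((P ∩ ∁ Even₁) ∩ Even₂) ⇿ ((P ∩ Even₁) ∩ ∁ Even₂)
  odd-even⇿even-odd = record
    { to      = rotate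
    ; from    = rotate ∘ rotate
    ; to-∈    = λ {u} ((p , y-odd) , k-even) →
                  let y′ , k′ = odd-even⇒rotate {u} y-odd k-even in (rotate-closed p , y′) , k′
    ; from-∈  = λ {u} ((p , y-even) , k-odd) →
                  let y′ , k′ = even-odd⇒rotate {u} y-even k-odd
                      y″ , k″ = odd-odd⇒rotate {rotate u} y′ k′
                  in (rotate-closed (rotate-closed p) , y″) , k″
    ; from∘to = λ {u} _ → rotate³ u
    ; to∘from = λ {u} _ → rotate³ u
    }

  odd-odd⇿even-odd : ((P ∩ ∁ Even₁) ∩ ∁ Even₂) ⇿ ((P ∩ Even₁) ∩ ∁ Even₂)
  odd-odd⇿even-odd = record
    { to      = rotate ∘ rotate
    ; from    = rotate
    ; to-∈    = λ {u} ((p , y-odd) , k-odd) →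
                  let y′ , k′ = odd-odd⇒rotate {u} y-odd k-odd
                      y″ , k″ = odd-even⇒rotate {rotate u} y′ k′
                  in (rotate-closed (rotate-closed p) , y″) , k″
    ; from-∈  = λ {u} ((p , y-even) , k-odd) →
                  let y′ , k′ = even-odd⇒rotate {u} y-even k-odd in (rotate-closed p , y′) , k′
    ; from∘to = λ {u} _ → rotate³ u
    ; to∘from = λ {u} _ → rotate³ u
    }

  length-odd-part : ∀ {xs} → Enumerates P xs →
    length (filter (∁? even₁?) xs) ≡ 2 * length (even-odd-part xs)
  length-odd-part {xs} E = begin
    length odds
      ≡⟨ length-filter-split even₂? odds ⟩
    length (filter even₂? odds) + length (filter (∁? even₂?) odds)
      ≡⟨ cong₂ _+_ (length-⇿ odd-even⇿even-odd (enumerates-filter even₂? E-odds) E-even-odd)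
                   (length-⇿ odd-odd⇿even-odd (enumerates-filter (∁? even₂?) E-odds) E-even-odd) ⟩
    length even-odd + length even-odd
      ≡⟨ cong (λ l → length even-odd + l) (sym (ℕP.+-identityʳ _)) ⟩
    2 * length even-odd ∎
    where
    open ≡-Reasoning
    odds even-odd : List ℤ⁴
    odds = filter (∁? even₁?) xs
    even-odd = even-odd-part xs
    E-odds : Enumerates (P ∩ ∁ Even₁) odds
    E-odds = enumerates-filter (∁? even₁?) E
    E-even-odd : Enumerates ((P ∩ Even₁) ∩ ∁ Even₂) even-odd
    E-even-odd = enumerates-filter (∁? even₂?) (enumerates-filter even₁? E)

length-even-part : (∀ {u} → P u → Even₁ u → ¬ Even₂ u) → Enumerates P xs →
  length (filter even₁? xs) ≡ length (even-odd-part xs)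
length-even-part {xs = xs} no-even-even E =
  trans (length-filter-split even₂? (filter even₁? xs))
        (cong (λ l → l + length (even-odd-part xs))
              (enumerates-empty (enumerates-filter even₂? (enumerates-filter even₁? E))
                                λ {u} ((p , y-even) , k-even) → no-even-even {u} p y-even k-even))

length-thirds : (∀ {u} → P u → P (rotate u)) → (∀ {u} → P u → Even₁ u → ¬ Even₂ u) →
  Enumerates P xs → length xs ≡ 3 * length (even-odd-part xs)
length-thirds {xs = xs} rotate-closed no-even-even E = begin
  length xs                                              ≡⟨ length-filter-split even₁? xs ⟩
  length (filter even₁? xs) + length (filter (∁? even₁?) xs)
    ≡⟨ cong₂ _+_ (length-even-part no-even-even E) (Rotation.length-odd-part rotate-closed E) ⟩
  3 * length (even-odd-part xs)                          ∎
  where open ≡-Reasoning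

-- The counting identity for the coefficients 2α + 1 and 4(2γ + 1)

+1+2* : ∀ m → + suc (2 * m) ≡ + 1 ℤ.+ + m ℤ.* + 2
+1+2* m = cong (λ t → + 1 ℤ.+ t) (trans (ℤP.pos-* 2 m) (ℤP.*-comm (+ 2) (+ m)))

module Counting (α γ n : ℕ) (n+γ+α-even : Even (+ (n + (γ + α)))) where

  a c K : ℕ
  a = suc (2 * α)
  c = suc (2 * γ)
  K = 2 * n + a + 2 * c

  Level : Pred ℤ⁴ 0ℓ
  Level = Q-level a (3 * a) (4 * c) (4 * c) (4 * K)

  a-odd : ¬ Even (+ a)
  a-odd 2∣a = ¬even-1+*2 (+ α) (subst Even (+1+2* α) 2∣a)

  Q-4c : ∀ x y z w → Q a (3 * a) (4 * c) (4 * c) (x , y , z , w)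
    ≡ + a ℤ.* (x ℤ.* x) ℤ.+ + 3 ℤ.* + a ℤ.* (y ℤ.* y) ℤ.+ + 4 ℤ.* + c ℤ.* (z ℤ.* z) ℤ.+ + 4 ℤ.* + c ℤ.* (w ℤ.* w)
  Q-4c x y z w = trans (Q-3a a (4 * c) (4 * c) x y z w)
    (cong (λ C → + a ℤ.* (x ℤ.* x) ℤ.+ + 3 ℤ.* + a ℤ.* (y ℤ.* y) ℤ.+ C ℤ.* (z ℤ.* z) ℤ.+ C ℤ.* (w ℤ.* w))
          (ℤP.pos-* 4 c))

  level≡4K : ∀ {v} → Level v → Q a (3 * a) (4 * c) (4 * c) v ≡ + 4 ℤ.* + K
  level≡4K level = trans level (ℤP.pos-* 4 K)

  K≡ : + K ≡ + 2 ℤ.* + n ℤ.+ (+ 1 ℤ.+ + α ℤ.* + 2) ℤ.+ + 2 ℤ.* (+ 1 ℤ.+ + γ ℤ.* + 2)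
  K≡ = trans (ℤP.pos-+ (2 * n + a) (2 * c))
    (cong₂ ℤ._+_ (trans (ℤP.pos-+ (2 * n) a) (cong₂ ℤ._+_ (ℤP.pos-* 2 n) (+1+2* α)))
                 (trans (ℤP.pos-* 2 c) (cong (+ 2 ℤ.*_) (+1+2* γ))))

  K-odd : ¬ Even (+ K)
  K-odd 2∣K = ¬even-1+*2 (+ n ℤ.+ + α ℤ.+ (+ 1 ℤ.+ + γ ℤ.* + 2))
    (subst Even (trans K≡ (regroup (+ n) (+ α) (+ γ))) 2∣K)
    where
    regroup : ∀ n α γ → + 2 ℤ.* n ℤ.+ (+ 1 ℤ.+ α ℤ.* + 2) ℤ.+ + 2 ℤ.* (+ 1 ℤ.+ γ ℤ.* + 2)
                       ≡ + 1 ℤ.+ (n ℤ.+ α ℤ.+ (+ 1 ℤ.+ γ ℤ.* + 2)) ℤ.* + 2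
    regroup = solve-∀

  4∣K-c-2 : + 4 ∣ + K ℤ.- + c ℤ.- + 2
  4∣K-c-2 = subst (+ 4 ∣_)
    (sym (trans (cong₂ (λ k c → k ℤ.- c ℤ.- + 2) K≡ (+1+2* γ))
                (trans (regroup (+ n) (+ α) (+ γ))
                       (cong (+ 2 ℤ.*_) (sym (trans (ℤP.pos-+ n (γ + α)) (cong (λ t → + n ℤ.+ t) (ℤP.pos-+ γ α))))))))
    (*-monoʳ-∣ (+ 2) n+γ+α-even)
    where
    regroup : ∀ n α γ → + 2 ℤ.* n ℤ.+ (+ 1 ℤ.+ α ℤ.* + 2) ℤ.+ + 2 ℤ.* (+ 1 ℤ.+ γ ℤ.* + 2)
                          ℤ.- (+ 1 ℤ.+ γ ℤ.* + 2) ℤ.- + 2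
                       ≡ + 2 ℤ.* (n ℤ.+ (γ ℤ.+ α))
    regroup = solve-∀

  x≡y-mod-2 : ∀ {v} → Level v → SameParity₁₂ v
  x≡y-mod-2 {x , y , z , w} level =
    even-square⁻ (∣m+n∣n⇒∣m (subst Even (B≡ x y) B-even) (even-*2 (y ℤ.* (x ℤ.+ y))))
    where
    B S : ℤ
    B = x ℤ.* x ℤ.+ + 3 ℤ.* (y ℤ.* y)
    S = z ℤ.* z ℤ.+ w ℤ.* w
    split : ∀ a c x y z w →
      a ℤ.* (x ℤ.* x) ℤ.+ + 3 ℤ.* a ℤ.* (y ℤ.* y) ℤ.+ + 4 ℤ.* c ℤ.* (z ℤ.* z) ℤ.+ + 4 ℤ.* c ℤ.* (w ℤ.* w)
      ≡ a ℤ.* (x ℤ.* x ℤ.+ + 3 ℤ.* (y ℤ.* y)) ℤ.+ + 4 ℤ.* (c ℤ.* (z ℤ.* z ℤ.+ w ℤ.* w))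
    split = solve-∀
    cancel : ∀ p q → p ≡ p ℤ.+ q ℤ.- q
    cancel = solve-∀
    B≡ : ∀ x y → x ℤ.* x ℤ.+ + 3 ℤ.* (y ℤ.* y) ≡ (x ℤ.- y) ℤ.* (x ℤ.- y) ℤ.+ y ℤ.* (x ℤ.+ y) ℤ.* + 2
    B≡ = solve-∀
    aB≡ : + a ℤ.* B ≡ + 4 ℤ.* + K ℤ.- + 4 ℤ.* (+ c ℤ.* S)
    aB≡ = trans (cancel (+ a ℤ.* B) (+ 4 ℤ.* (+ c ℤ.* S)))
      (cong (ℤ._- + 4 ℤ.* (+ c ℤ.* S))
        (trans (sym (split (+ a) (+ c) x y z w)) (trans (sym (Q-4c x y z w)) (level≡4K {x , y , z , w} level))))
    B-even : Even B
    B-even = even-*-odd⁻ a-odd (subst Even (sym aB≡)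
      (∣m∣n⇒∣m-n (∣m⇒∣m*n (+ K) 2∣4) (∣m⇒∣m*n (+ c ℤ.* S) 2∣4)))

  reduced-level : ∀ {y k z w} → Level (shear (y , k , z , w)) →
    + a ℤ.* norm y k ℤ.+ + c ℤ.* (z ℤ.* z ℤ.+ w ℤ.* w) ≡ + K
  reduced-level {y} {k} {z} {w} level = ℤP.*-cancelˡ-≡ (+ 4) _ _
    (trans (sym (trans (Q-4c (y ℤ.+ k ℤ.* + 2) y z w) (expand (+ a) (+ c) y k z w)))
           (level≡4K {shear (y , k , z , w)} level))
    where
    expand : ∀ a c y k z w →
      a ℤ.* ((y ℤ.+ k ℤ.* + 2) ℤ.* (y ℤ.+ k ℤ.* + 2)) ℤ.+ + 3 ℤ.* a ℤ.* (y ℤ.* y)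
        ℤ.+ + 4 ℤ.* c ℤ.* (z ℤ.* z) ℤ.+ + 4 ℤ.* c ℤ.* (w ℤ.* w)
      ≡ + 4 ℤ.* (a ℤ.* (y ℤ.* y ℤ.+ y ℤ.* k ℤ.+ k ℤ.* k) ℤ.+ c ℤ.* (z ℤ.* z ℤ.+ w ℤ.* w))
    expand = solve-∀

  -- If z ≢ w then a·norm ≡ 2 (mod 4), whereas an even norm is divisible by 4.
  z≡w-mod-2 : ∀ {y k z w} → + a ℤ.* norm y k ℤ.+ + c ℤ.* (z ℤ.* z ℤ.+ w ℤ.* w) ≡ + K → Even (z ℤ.- w)
  z≡w-mod-2 {y} {k} {z} {w} eq with even? (z ℤ.- w)
  ... | yes z-w-even = z-w-even
  ... | no  z-w-odd  = ⊥-elim (¬4∣2 (subst (+ 4 ∣_) (difference aN) (∣m∣n⇒∣m-n 4∣aN 4∣aN-2)))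
    where
    S aN : ℤ
    S = z ℤ.* z ℤ.+ w ℤ.* w
    aN = + a ℤ.* norm y k
    shift : ∀ aN c S → aN ℤ.- + 2 ≡ aN ℤ.+ c ℤ.* S ℤ.- c ℤ.- + 2 ℤ.- c ℤ.* (S ℤ.- + 1)
    shift = solve-∀
    difference : ∀ p → p ℤ.- (p ℤ.- + 2) ≡ + 2
    difference = solve-∀
    restore : ∀ p → p ℤ.- + 2 ℤ.+ + 2 ≡ p
    restore = solve-∀
    4∣aN-2 : + 4 ∣ aN ℤ.- + 2
    4∣aN-2 = subst (+ 4 ∣_)
      (sym (trans (shift aN (+ c) S) (cong (λ t → t ℤ.- + c ℤ.- + 2 ℤ.- + c ℤ.* (S ℤ.- + 1)) eq)))
      (∣m∣n⇒∣m-n 4∣K-c-2 (∣n⇒∣m*n (+ c) (4∣sum-of-squares-1 {z} {w} z-w-odd)))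
    aN-even : Even aN
    aN-even = subst Even (restore aN) (∣m∣n⇒∣m+n (∣-trans 2∣4 4∣aN-2) (even-*2 (+ 1)))
    4∣aN : + 4 ∣ aN
    4∣aN = let y-even , k-even = even-norm⁻ {y} {k} (even-*-odd⁻ a-odd aN-even) in
      ∣n⇒∣m*n (+ a) (∣m∣n⇒∣m+n (∣m∣n⇒∣m+n (4∣even*even y-even y-even) (4∣even*even y-even k-even))
                                 (4∣even*even k-even k-even))

  y-even⇒k-odd : ∀ {y k z w} → + a ℤ.* norm y k ℤ.+ + c ℤ.* (z ℤ.* z ℤ.+ w ℤ.* w) ≡ + K →
    Even y → ¬ Even k
  y-even⇒k-odd {y} {k} {z} {w} eq y-even k-even =
    K-odd (subst Even eq (∣m∣n⇒∣m+n (∣n⇒∣m*n (+ a) N-even) (∣n⇒∣m*n (+ c) S-even)))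
    where
    N-even : Even (norm y k)
    N-even = ∣m∣n⇒∣m+n (∣m∣n⇒∣m+n (∣m⇒∣m*n y y-even) (∣m⇒∣m*n k y-even)) (∣n⇒∣m*n k k-even)
    S≡ : ∀ z w → z ℤ.* z ℤ.+ w ℤ.* w ≡ (z ℤ.- w) ℤ.* (z ℤ.- w) ℤ.+ z ℤ.* w ℤ.* + 2
    S≡ = solve-∀
    S-even : Even (z ℤ.* z ℤ.+ w ℤ.* w)
    S-even = subst Even (sym (S≡ z w))
      (∣m∣n⇒∣m+n (∣m⇒∣m*n (z ℤ.- w) (z≡w-mod-2 {y} {k} {z} {w} eq)) (even-*2 (z ℤ.* w)))

  ShearedLevel : Pred ℤ⁴ 0ℓ
  ShearedLevel = Level ∘ shear

  shear-level-⇿ : Level ⇿ ShearedLevel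
  shear-level-⇿ = shear-⇿ {P = Level} (λ {v} → x≡y-mod-2 {v})

  rotate-closed : ∀ {u} → ShearedLevel u → ShearedLevel (rotate u)
  rotate-closed {u} = trans (Q-shear-rotate a (4 * c) (4 * c) u)

  sheared-z≡w : ∀ {y k z w} → ShearedLevel (y , k , z , w) → Even (z ℤ.- w)
  sheared-z≡w {y} {k} {z} {w} = z≡w-mod-2 {y} {k} {z} {w} ∘ reduced-level {y} {k} {z} {w}

  no-even-even : ∀ {u} → ShearedLevel u → Even₁ u → ¬ Even₂ u
  no-even-even {y , k , z , w} = y-even⇒k-odd {y} {k} {z} {w} ∘ reduced-level {y} {k} {z} {w}

  Level-even⇿sheared : (Level ∩ All₄ Even) ⇿ ((ShearedLevel ∩ Even₃) ∩ Even₁)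
  Level-even⇿sheared = ⇿-restrict shear-level-⇿ proj₁ (proj₁ ∘ proj₁)
    (λ {(x , y , z , w)} (level , _ , y-even , z-even , _) → (to-∈ shear-level-⇿ {x , y , z , w} level , z-even) , y-even)
    (λ {(y , k , z , w)} ((level , z-even) , y-even) →
       level , ∣m∣n⇒∣m+n y-even (even-*2 k) , y-even , z-even ,
       even-neg⁻ (∣m+n∣m⇒∣n (sheared-z≡w {y} {k} {z} {w} level) z-even))

  Level-odd⇿sheared : (Level ∩ All₄ (∁ Even)) ⇿ ((ShearedLevel ∩ ∁ Even₃) ∩ ∁ Even₁)
  Level-odd⇿sheared = ⇿-restrict shear-level-⇿ proj₁ (proj₁ ∘ proj₁)
    (λ {(x , y , z , w)} (level , _ , y-odd , z-odd , _) → (to-∈ shear-level-⇿ {x , y , z , w} level , z-odd) , y-odd)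
    (λ {(y , k , z , w)} ((level , z-odd) , y-odd) →
       level , (λ 2∣x → y-odd (∣m+n∣n⇒∣m 2∣x (even-*2 k))) , y-odd , z-odd ,
       λ w-even → z-odd (∣m+n∣n⇒∣m (sheared-z≡w {y} {k} {z} {w} level) (∣m⇒∣-m w-even)))

  T2-level⇿Level-odd : T2-level a (3 * a) (4 * c) (4 * c) n ⇿ (Level ∩ All₄ (∁ Even))
  T2-level⇿Level-odd =
    subst (λ R → T2-level a (3 * a) (4 * c) (4 * c) n ⇿ (Q-level a (3 * a) (4 * c) (4 * c) R ∩ All₄ (∁ Even)))
          (level n a c) (T2-level⇿odd-reps a (3 * a) (4 * c) (4 * c) n)
    where
    level : ∀ n a c → 4 * (2 * n) + (a + 3 * a + 4 * c + 4 * c) ≡ 4 * (2 * n + a + 2 * c)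
    level = ℕ-Solver.solve-∀

  reps : List ℤ⁴
  reps = filter (λ v → Q a (3 * a) (4 * c) (4 * c) v ℤP.≟ + (4 * K)) (box (suc (4 * K)))

  sheared-reps z-even-reps z-odd-reps : List ℤ⁴
  sheared-reps = map unshear reps
  z-even-reps  = filter even₃? sheared-reps
  z-odd-reps   = filter (∁? even₃?) sheared-reps

  sheared-reps-enumerates : Enumerates ShearedLevel sheared-reps
  sheared-reps-enumerates = enumerates-map shear-level-⇿ (N-enumerates a (3 * a) (4 * c) (4 * c) (4 * K))

  z-even-enumerates : Enumerates (ShearedLevel ∩ Even₃) z-even-reps
  z-even-enumerates = enumerates-filter even₃? sheared-reps-enumerates

  z-odd-enumerates : Enumerates (ShearedLevel ∩ ∁ Even₃) z-odd-reps
  z-odd-enumerates = enumerates-filter (∁? even₃?) sheared-reps-enumerates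

  N-4K≡ : N a (3 * a) (4 * c) (4 * c) (4 * K)
        ≡ 3 * length (even-odd-part z-even-reps) + 3 * length (even-odd-part z-odd-reps)
  N-4K≡ = begin
    N a (3 * a) (4 * c) (4 * c) (4 * K)        ≡⟨ sym (length-map unshear reps) ⟩
    length sheared-reps                        ≡⟨ length-filter-split even₃? sheared-reps ⟩
    length z-even-reps + length z-odd-reps
      ≡⟨ cong₂ _+_ (length-thirds (λ {u} (level , z-even) → rotate-closed {u} level , z-even)
                                  (λ {u} (level , _) → no-even-even {u} level) z-even-enumerates)
                   (length-thirds (λ {u} (level , z-odd) → rotate-closed {u} level , z-odd)
                                  (λ {u} (level , _) → no-even-even {u} level) z-odd-enumerates) ⟩
    3 * length (even-odd-part z-even-reps) + 3 * length (even-odd-part z-odd-reps) ∎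
    where open ≡-Reasoning

  N-K≡ : N a (3 * a) (4 * c) (4 * c) K ≡ length (even-odd-part z-even-reps)
  N-K≡ = trans (length-⇿ (⇿-trans (Q-level⇿even-reps a (3 * a) (4 * c) (4 * c) K) Level-even⇿sheared)
                         (N-enumerates a (3 * a) (4 * c) (4 * c) K) (enumerates-filter even₁? z-even-enumerates))
               (length-even-part (λ {u} (level , _) → no-even-even {u} level) z-even-enumerates)

  t≡ : t a (3 * a) (4 * c) (4 * c) n ≡ 2 * length (even-odd-part z-odd-reps)
  t≡ = trans (length-⇿ (⇿-trans T2-level⇿Level-odd Level-odd⇿sheared)
                       (t-enumerates a (3 * a) (4 * c) (4 * c) n) (enumerates-filter (∁? even₁?) z-odd-enumerates))
             (Rotation.length-odd-part (λ {u} (level , z-odd) → rotate-closed {u} level , z-odd) z-odd-enumerates)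

  count-identity : 2 * N a (3 * a) (4 * c) (4 * c) (4 * K)
                 ≡ 3 * t a (3 * a) (4 * c) (4 * c) n + 6 * N a (3 * a) (4 * c) (4 * c) K
  count-identity = begin
    2 * N a (3 * a) (4 * c) (4 * c) (4 * K)                            ≡⟨ cong (2 *_) N-4K≡ ⟩
    2 * (3 * B₀ + 3 * B₁)                                              ≡⟨ arithmetic B₀ B₁ ⟩
    3 * (2 * B₁) + 6 * B₀                                              ≡⟨ sym (cong₂ (λ t N → 3 * t + 6 * N) t≡ N-K≡) ⟩
    3 * t a (3 * a) (4 * c) (4 * c) n + 6 * N a (3 * a) (4 * c) (4 * c) K ∎
    where
    open ≡-Reasoning
    B₀ B₁ : ℕ
    B₀ = length (even-odd-part z-even-reps)
    B₁ = length (even-odd-part z-odd-reps)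
    arithmetic : ∀ B₀ B₁ → 2 * (3 * B₀ + 3 * B₁) ≡ 3 * (2 * B₁) + 6 * B₀
    arithmetic = ℕ-Solver.solve-∀

≡-mod-2⇒even-sum : ∀ p q → p % 2 ≡ q % 2 → Even (+ (p + q))
≡-mod-2⇒even-sum p q p≡q = divides (+ (q % 2 + p / 2 + q / 2)) (trans (cong +_ sum≡) (ℤP.pos-* (q % 2 + p / 2 + q / 2) 2))
  where
  regroup : ∀ r s t → (r + s * 2) + (r + t * 2) ≡ (r + s + t) * 2
  regroup = ℕ-Solver.solve-∀
  sum≡ : p + q ≡ (q % 2 + p / 2 + q / 2) * 2
  sum≡ = begin
    p + q                                      ≡⟨ cong₂ _+_ (m≡m%n+[m/n]*n p 2) (m≡m%n+[m/n]*n q 2) ⟩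
    (p % 2 + p / 2 * 2) + (q % 2 + q / 2 * 2)  ≡⟨ cong (λ r → (r + p / 2 * 2) + (q % 2 + q / 2 * 2)) p≡q ⟩
    (q % 2 + p / 2 * 2) + (q % 2 + q / 2 * 2)  ≡⟨ regroup (q % 2) (p / 2) (q / 2) ⟩
    (q % 2 + p / 2 + q / 2) * 2                ∎
    where open ≡-Reasoning

odd-form : ∀ a → a % 2 ≡ 1 → a ≡ suc (2 * (a / 2))
odd-form a a%2≡1 = trans (m≡m%n+[m/n]*n a 2) (cong₂ _+_ a%2≡1 (ℕP.*-comm (a / 2) 2))

half-pred-odd : ∀ α → (suc (2 * α) ∸ 1) / 2 ≡ α
half-pred-odd α = trans (cong (_/ 2) (ℕP.*-comm 2 α)) (m*n/n≡m α 2)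

Theorem2p3 : ℕ → ℕ → ℕ → Set
Theorem2p3 a m n = + (3 * t a (3 * a) (8 * m + 4) (8 * m + 4) n)
    ≡ + (2 * N a (3 * a) (8 * m + 4) (8 * m + 4) (8 * n + 16 * m + 4 * a + 8))
    ℤ.- + (6 * N a (3 * a) (8 * m + 4) (8 * m + 4) (2 * n + 4 * m + a + 2))

theorem2p3-odd : ∀ α m n → n % 2 ≡ (m + α) % 2 → Theorem2p3 (suc (2 * α)) m n
theorem2p3-odd α m n n≡m+α = begin
  + (3 * t a b C C n)                                            ≡⟨ sym (ℤ-cancel (3 * t a b C C n) (6 * N a b C C K)) ⟩
  + (3 * t a b C C n + 6 * N a b C C K) ℤ.- + (6 * N a b C C K)  ≡⟨ cong (λ s → + s ℤ.- + (6 * N a b C C K)) (sym identity) ⟩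
  + (2 * N a b C C M) ℤ.- + (6 * N a b C C K)                    ∎
  where
  open ≡-Reasoning
  open Counting α m n (≡-mod-2⇒even-sum n (m + α) n≡m+α) using (count-identity)
  a b C M K : ℕ
  a = suc (2 * α)
  b = 3 * a
  C = 8 * m + 4
  M = 8 * n + 16 * m + 4 * a + 8
  K = 2 * n + 4 * m + a + 2
  ℤ-cancel : ∀ p q → + (p + q) ℤ.- + q ≡ + p
  ℤ-cancel p q = trans (cong (ℤ._- + q) (ℤP.pos-+ p q)) (cancel (+ p) (+ q))
    where
    cancel : ∀ p q → p ℤ.+ q ℤ.- q ≡ p
    cancel = solve-∀
  transport : ∀ {C C′ M M′ K K′} → C ≡ C′ → M ≡ M′ → K ≡ K′ →
    2 * N a b C C M ≡ 3 * t a b C C n + 6 * N a b C C K →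
    2 * N a b C′ C′ M′ ≡ 3 * t a b C′ C′ n + 6 * N a b C′ C′ K′
  transport refl refl refl eq = eq
  C≡ : ∀ m → 4 * suc (2 * m) ≡ 8 * m + 4
  C≡ = ℕ-Solver.solve-∀
  M≡ : ∀ n m a → 4 * (2 * n + a + 2 * suc (2 * m)) ≡ 8 * n + 16 * m + 4 * a + 8
  M≡ = ℕ-Solver.solve-∀
  K≡ : ∀ n m a → 2 * n + a + 2 * suc (2 * m) ≡ 2 * n + 4 * m + a + 2
  K≡ = ℕ-Solver.solve-∀
  identity : 2 * N a b C C M ≡ 3 * t a b C C n + 6 * N a b C C K
  identity = transport (C≡ m) (M≡ n m a) (K≡ n m a) count-identity

theorem2p3 : (a m n : ℕ) → 0 < a → a % 2 ≡ 1 → 0 < n →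
    n % 2 ≡ (m + (a ∸ 1) / 2) % 2 →
    + (3 * t a (3 * a) (8 * m + 4) (8 * m + 4) n)
    ≡ + (2 * N a (3 * a) (8 * m + 4) (8 * m + 4) (8 * n + 16 * m + 4 * a + 8))
    ℤ.- + (6 * N a (3 * a) (8 * m + 4) (8 * m + 4) (2 * n + 4 * m + a + 2))
theorem2p3 a m n _ a%2≡1 _ n≡m+[a-1]/2 =
  subst (λ a → Theorem2p3 a m n) (sym a≡) (theorem2p3-odd (a / 2) m n n≡m+α)
  where
  a≡ : a ≡ suc (2 * (a / 2))
  a≡ = odd-form a a%2≡1
  n≡m+α : n % 2 ≡ (m + a / 2) % 2
  n≡m+α = trans n≡m+[a-1]/2 (cong (λ h → (m + h) % 2) (trans (cong (λ a → (a ∸ 1) / 2) a≡) (half-pred-odd (a / 2))))
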